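{- Let $\Sigma,\Gamma$ be finite alphabets with at least two letters each, $\mathcal{I}$ the set of injective morphisms $\Sigma^*\to\Gamma^*$, and $a,b\in\Sigma$ distinct letters. For every integer $n\ge 2$, $$\mathrm{E}_{\mathcal{I}}((ab)^n ba)=1+\frac{2}{n-1}.$$
   Context: For a nonempty word $v$ and natural number $p$, $v^{p/|v|}$ is the prefix of length $p$ of $vvv\cdots$. The fractional exponent of a nonempty word $u$ is $\mathrm{E}(u)=\sup\{r\in\mathbb{Q}\mid\exists v\ne\varepsilon: u=v^r\}$, and $\mathrm{E}_{\mathcal{I}}(u)=\sup\{\mathrm{E}(h(u))\mid h\in\mathcal{I}\}$. -}

module Defs where

open import Data.Nat as ℕ using (ℕ; zero; suc; _≤_; s≤s; z≤n)
open import Data.Integer using (+_)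
open import Data.Rational as ℚ using (ℚ; 1ℚ)
open import Data.List using (List; []; _∷_; _++_; take; concat; replicate; length; concatMap)
open import Data.Fin using (Fin)
open import Data.Product using (Σ; ∃; _×_; _,_)
open import Relation.Binary.PropositionalEquality using (_≡_; _≢_)

-- v^{p/|v|} : the prefix of length p of v v v ...  (for nonempty v,
-- p copies of v are enough)
pow : {A : Set} → List A → ℕ → List A
pow v p = take p (concat (replicate p v))

-- u = v^r  for a rational r, with v nonempty (written x ∷ xs):
-- r = p / |v| and u is the prefix of length p of vvv...
IsPowerOf : {A : Set} → List A → ℚ → Set
IsPowerOf {A} u r =
  ∃ λ (x : A) → ∃ λ (xs : List A) → ∃ λ (p : ℕ) →
    (r ≡ (+ p) ℚ./ length (x ∷ xs)) × (u ≡ pow (x ∷ xs) p)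

IsSup : (ℚ → Set) → ℚ → Set
IsSup S q =
  (∀ r → S r → r ℚ.≤ q) ×
  (∀ q' → q' ℚ.< q → ∃ λ r → S r × (q' ℚ.< r))

IsExponent : {A : Set} → List A → ℚ → Set
IsExponent u e = IsSup (IsPowerOf u) e

-- morphisms Σ* → Γ*, Σ = Fin s, Γ = Fin g, given by images of letters
Morphism : ℕ → ℕ → Set
Morphism s g = Fin s → List (Fin g)

apply : {s g : ℕ} → Morphism s g → List (Fin s) → List (Fin g)
apply h u = concatMap h u

Injective : {s g : ℕ} → Morphism s g → Set
Injective {s} h = (u w : List (Fin s)) → apply h u ≡ apply h w → u ≡ w

IsInjExponent : (s g : ℕ) → List (Fin s) → ℚ → Set
IsInjExponent s g u e =
  IsSup (λ r → Σ (Morphism s g) λ h → Injective h × IsExponent (apply h u) r) e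

word : {A : Set} → A → A → ℕ → List A
word a b n = concat (replicate n (a ∷ b ∷ [])) ++ (b ∷ a ∷ [])

bound : (n : ℕ) → 2 ≤ n → ℚ
bound (suc (suc m)) _ = 1ℚ ℚ.+ (+ 2) ℚ./ suc m
bound (suc zero) (s≤s ())

module Submission where

-- Write X = h(ab) and Y = h(ba) for an injective h, so h((ab)^n ba) = X^n Y with |X| = |Y| = L
-- and X ≠ Y.  If this word had a period q < (n-1)L, then q and L would both be periods of the
-- prefix X^n, which is long enough for the Fine–Wilf theorem: gcd(q, L) is a period of X^n,
-- extends to the whole word, and so L is a period, forcing Y = X.  Every period is therefore
-- at least (n-1)L and the exponent is at most (n+1)L/((n-1)L) = 1 + 2/(n-1).
-- Conversely, the prefix code a ↦ x(yx)^K, b ↦ yx gives X^n Y a border of length 2L - 2,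
-- i.e. the period (n-1)L + 2 with L = 2K + 3, and the exponents (n+1)L/((n-1)L + 2) tend to
-- 1 + 2/(n-1) as K grows.

open import Defs
open import Data.Nat as ℕ
  using (ℕ; zero; suc; _+_; _*_; _∸_; _≤_; _<_; z≤n; s≤s; _<?_)
open import Data.Nat.Properties as ℕ
  using (≤-trans; <-≤-trans; ≤-<-trans; m≤m+n; m≤n+m; +-comm; +-assoc; ≮⇒≥)
open import Data.Nat.Divisibility using (_∣_; divides; ∣-trans; n∣m*n)
open import Data.Nat.GCD
  using (gcd; gcd-GCD; module GCD; gcd-comm; gcd-identityˡ; gcd-identityʳ; gcd[m,n]∣n; gcd[m,n]≤n)
open import Data.Nat.Induction using (<-rec; <-wellFounded)
open import Data.Nat.Tactic.RingSolver using (solve-∀)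
open import Data.Integer as ℤ using (ℤ; +_; -[1+_])
import Data.Integer.Properties as ℤ
import Data.Integer.Tactic.RingSolver as ℤ-Ring
open import Data.Rational as ℚ using (ℚ; _/_; 1ℚ)
import Data.Rational.Properties as ℚ
open import Data.Rational.Unnormalised as ℚᵘ using (mkℚᵘ; *≤*; *<*; *≡*)
import Data.Rational.Unnormalised.Properties as ℚᵘ
open import Data.List using (List; []; _∷_; _++_; take; drop; length; concat; replicate)
open import Data.List.Properties as List using (length-++; ++-assoc)
open import Data.Fin using (Fin; toℕ) renaming (zero to fzero; suc to fsuc)
import Data.Fin.Properties as Fin
open import Data.Maybe using (Maybe; just; nothing)
import Data.Maybe.Properties as Maybe
open import Data.Product using (Σ; ∃-syntax; _×_; _,_; proj₁; proj₂)
open import Data.Sum using (_⊎_; inj₁; inj₂)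
open import Data.Empty using (⊥-elim)
open import Induction.WellFounded using (Acc; acc)
open import Relation.Nullary using (¬_; Dec; yes; no; _×-dec_)
open import Relation.Nullary.Decidable using (map′)
open import Relation.Unary using (Decidable)
open import Relation.Binary.Definitions using (DecidableEquality)
open import Relation.Binary.PropositionalEquality

-- Arithmetic

<-or-+ : ∀ p i → i < p ⊎ ∃[ j ] p + j ≡ i
<-or-+ p i with i <? p
... | yes i<p = inj₁ i<p
... | no  i≮p = inj₂ (ℕ.m≤n⇒∃[o]m+o≡n (≮⇒≥ i≮p))

gcd[m,m+n]≡gcd[m,n] : ∀ m n → gcd m (m + n) ≡ gcd m n
gcd[m,m+n]≡gcd[m,n] m n = GCD.unique (gcd-GCD m (m + n)) (GCD.step (gcd-GCD m n))

least-witness : ∀ {P : ℕ → Set} → Decidable P → ∀ {n} → P n →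
  ∃[ m ] P m × (∀ {k} → k < m → ¬ P k)
least-witness {P} P? {n} = go n (<-wellFounded n)
  where
  go : ∀ n → Acc _<_ n → P n → ∃[ m ] P m × (∀ {k} → k < m → ¬ P k)
  go n (acc rs) Pn with ℕ.anyUpTo? P? n
  ... | yes (k , k<n , Pk) = go k (rs k<n) Pk
  ... | no  none           = n , Pn , λ k<n Pk → none (_ , k<n , Pk)

toℚᵘ-/ : ∀ p d → ℚ.toℚᵘ (p / suc d) ℚᵘ.≃ mkℚᵘ p d
toℚᵘ-/ p d = ℚ.toℚᵘ-fromℚᵘ (mkℚᵘ p d)

*≤*⇒/≤/ : ∀ a b m n → a * suc n ≤ b * suc m → + a / suc m ℚ.≤ + b / suc n
*≤*⇒/≤/ a b m n le = ℚ.toℚᵘ-cancel-≤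
  (ℚᵘ.≤-respˡ-≃ (ℚᵘ.≃-sym (toℚᵘ-/ (+ a) m)) (ℚᵘ.≤-respʳ-≃ (ℚᵘ.≃-sym (toℚᵘ-/ (+ b) n))
    (*≤* (subst₂ ℤ._≤_ (ℤ.pos-* a (suc n)) (ℤ.pos-* b (suc m)) (ℤ.+≤+ le)))))

*<*⇒/</ : ∀ p q m n → p ℤ.* + suc n ℤ.< q ℤ.* + suc m → p / suc m ℚ.< q / suc n
*<*⇒/</ p q m n lt = ℚ.toℚᵘ-cancel-<
  (ℚᵘ.<-respˡ-≃ (ℚᵘ.≃-sym (toℚᵘ-/ p m)) (ℚᵘ.<-respʳ-≃ (ℚᵘ.≃-sym (toℚᵘ-/ q n)) (*<* lt)))

/</⇒*<* : ∀ p q m n → p / suc m ℚ.< q / suc n → p ℤ.* + suc n ℤ.< q ℤ.* + suc m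
/</⇒*<* p q m n lt
  with ℚᵘ.<-respˡ-≃ (toℚᵘ-/ p m) (ℚᵘ.<-respʳ-≃ (toℚᵘ-/ q n) (ℚ.toℚᵘ-mono-< lt))
... | *<* lt′ = lt′

1+2/[1+m]≡[3+m]/[1+m] : ∀ m → 1ℚ ℚ.+ + 2 / suc m ≡ + (3 + m) / suc m
1+2/[1+m]≡[3+m]/[1+m] m = ℚ.toℚᵘ-injective (begin
  ℚ.toℚᵘ (1ℚ ℚ.+ + 2 / suc m)         ≈⟨ ℚ.toℚᵘ-homo-+ 1ℚ (+ 2 / suc m) ⟩
  ℚ.toℚᵘ 1ℚ ℚᵘ.+ ℚ.toℚᵘ (+ 2 / suc m) ≈⟨ ℚᵘ.+-congʳ (ℚ.toℚᵘ 1ℚ) (toℚᵘ-/ (+ 2) m) ⟩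
  ℚ.toℚᵘ 1ℚ ℚᵘ.+ mkℚᵘ (+ 2) m         ≈⟨ *≡* (cong +_ (cross m)) ⟩
  mkℚᵘ (+ (3 + m)) m                   ≈⟨ toℚᵘ-/ (+ (3 + m)) m ⟨
  ℚ.toℚᵘ (+ (3 + m) / suc m)           ∎)
  where
  open ℚᵘ.≃-Reasoning
  cross : ∀ m → (1 * suc m + 2 * 1) * suc m ≡ (3 + m) * (1 * suc m)
  cross = solve-∀

-- The ratios bL / (aL + 2) increase to b / a; once L > 2P they exceed every P / c below b / a.
ratio-cross : ∀ P a b c L → P ℤ.* + a ℤ.< + b ℤ.* + c → P ℤ.* + 2 ℤ.< + L →
  P ℤ.* + (2 + a * L) ℤ.< + (b * L) ℤ.* + c
ratio-cross P a b c L Pa<bc 2P<L = begin-strict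
  P ℤ.* + (2 + a * L)                 ≡⟨ cong (P ℤ.*_) cast ⟩
  P ℤ.* (+ 2 ℤ.+ + a ℤ.* + L)         ≡⟨ ring₁ P (+ a) (+ L) ⟩
  P ℤ.* + 2 ℤ.+ (P ℤ.* + a) ℤ.* + L   <⟨ ℤ.+-monoˡ-< ((P ℤ.* + a) ℤ.* + L) 2P<L ⟩
  + L ℤ.+ (P ℤ.* + a) ℤ.* + L         ≡⟨ ring₂ (P ℤ.* + a) (+ L) ⟩
  (+ 1 ℤ.+ P ℤ.* + a) ℤ.* + L         ≤⟨ ℤ.*-monoʳ-≤-nonNeg (+ L) (ℤ.i<j⇒suc[i]≤j Pa<bc) ⟩
  (+ b ℤ.* + c) ℤ.* + L               ≡⟨ ring₃ (+ b) (+ c) (+ L) ⟩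
  (+ b ℤ.* + L) ℤ.* + c               ≡⟨ cong (ℤ._* + c) (ℤ.pos-* b L) ⟨
  + (b * L) ℤ.* + c                   ∎
  where
  open ℤ.≤-Reasoning
  cast : + (2 + a * L) ≡ + 2 ℤ.+ + a ℤ.* + L
  cast = trans (ℤ.pos-+ 2 (a * L)) (cong (ℤ._+_ (+ 2)) (ℤ.pos-* a L))
  ring₁ : ∀ P a L → P ℤ.* (+ 2 ℤ.+ a ℤ.* L) ≡ P ℤ.* + 2 ℤ.+ (P ℤ.* a) ℤ.* L
  ring₁ = ℤ-Ring.solve-∀
  ring₂ : ∀ x L → L ℤ.+ x ℤ.* L ≡ (+ 1 ℤ.+ x) ℤ.* L
  ring₂ = ℤ-Ring.solve-∀
  ring₃ : ∀ b c L → (b ℤ.* c) ℤ.* L ≡ (b ℤ.* L) ℤ.* c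
  ring₃ = ℤ-Ring.solve-∀

P*2<3+2∣P∣ : ∀ P → P ℤ.* + 2 ℤ.< + (3 + 2 * ℤ.∣ P ∣)
P*2<3+2∣P∣ (+ k)    = subst (ℤ._< + (3 + 2 * k)) (ℤ.pos-* k 2)
  (ℤ.+<+ (s≤s (≤-trans (ℕ.≤-reflexive (ℕ.*-comm k 2)) (m≤n+m (2 * k) 2))))
P*2<3+2∣P∣ -[1+ k ] = ℤ.-<+

ratio-exceeds : ∀ q m L → ℚ.↥ q ℤ.* + 2 ℤ.< + L → q ℚ.< + (3 + m) / suc m →
  q ℚ.< + ((3 + m) * L) / (2 + suc m * L)
ratio-exceeds q m L 2P<L q<b = subst (ℚ._< _) (ℚ.↥p/↧p≡p q)
  (*<*⇒/</ P (+ ((3 + m) * L)) d (suc (suc m * L))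
    (ratio-cross P (suc m) (3 + m) (ℚ.↧ₙ q) L
      (/</⇒*<* P (+ (3 + m)) d m (subst (ℚ._< _) (sym (ℚ.↥p/↧p≡p q)) q<b)) 2P<L))
  where
  P = ℚ.↥ q
  d = ℚ.denominator-1 q

maximum⇒IsSup : ∀ {S : ℚ → Set} {q} → S q → (∀ r → S r → r ℚ.≤ q) → IsSup S q
maximum⇒IsSup Sq ub = ub , λ _ q′<q → _ , Sq , q′<q

IsSup-least : ∀ {S : ℚ → Set} {q c} → IsSup S q → (∀ r → S r → r ℚ.≤ c) → q ℚ.≤ c
IsSup-least (_ , approx) ub = ℚ.≮⇒≥ λ c<q →
  let (r , Sr , c<r) = approx _ c<q in ℚ.<-irrefl refl (ℚ.<-≤-trans c<r (ub r Sr))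

-- Periods of words

module _ {A : Set} where

  infixl 5 _!_
  _!_ : List A → ℕ → Maybe A
  []       ! _     = nothing
  (x ∷ xs) ! zero  = just x
  (x ∷ xs) ! suc i = xs ! i

  !-++ˡ : ∀ (u : List A) {v i} → i < length u → (u ++ v) ! i ≡ u ! i
  !-++ˡ (x ∷ u) {i = zero}  _        = refl
  !-++ˡ (x ∷ u) {i = suc i} (s≤s lt) = !-++ˡ u lt

  !-++ʳ : ∀ (u : List A) {v} i → (u ++ v) ! (length u + i) ≡ v ! i
  !-++ʳ []      i = refl
  !-++ʳ (x ∷ u) i = !-++ʳ u i

  !-take : ∀ n (w : List A) {i} → i < n → take n w ! i ≡ w ! i
  !-take (suc n) []      _        = refl
  !-take (suc n) (x ∷ w) {zero}  _        = refl
  !-take (suc n) (x ∷ w) {suc i} (s≤s lt) = !-take n w lt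

  !-ext : ∀ {u v : List A} → length u ≡ length v →
          (∀ i → i < length u → u ! i ≡ v ! i) → u ≡ v
  !-ext {[]}    {[]}    _  _ = refl
  !-ext {x ∷ u} {y ∷ v} eq f with refl ← f 0 (s≤s z≤n) =
    cong (x ∷_) (!-ext (ℕ.suc-injective eq) (λ i lt → f (suc i) (s≤s lt)))

  record HasPeriod (w : List A) (p : ℕ) : Set where
    constructor period
    field shift : ∀ i → i + p < length w → w ! i ≡ w ! (i + p)

  open HasPeriod public

  HasPeriod-length : ∀ (w : List A) → HasPeriod w (length w)
  HasPeriod-length w = period λ i lt → ⊥-elim (ℕ.m+n≮n i (length w) lt)

  HasPeriod-++ˡ : ∀ {u v : List A} {p} → HasPeriod (u ++ v) p → HasPeriod u p
  HasPeriod-++ˡ {u} {v} {p} per = period λ i lt → begin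
    u ! i             ≡⟨ !-++ˡ u (≤-<-trans (m≤m+n i p) lt) ⟨
    (u ++ v) ! i      ≡⟨ shift per i (<-≤-trans lt (List.length-++-≤ˡ u)) ⟩
    (u ++ v) ! (i + p) ≡⟨ !-++ˡ u lt ⟩
    u ! (i + p)       ∎
    where open ≡-Reasoning

  HasPeriod-take : ∀ {w : List A} {p} n → HasPeriod w p → HasPeriod (take n w) p
  HasPeriod-take {w} n per = HasPeriod-++ˡ {u = take n w} {v = drop n w}
    (subst (λ z → HasPeriod z _) (sym (List.take++drop≡id n w)) per)

  border⇒HasPeriod : ∀ {t v z w : List A} → t ++ v ≡ w → v ++ z ≡ w → HasPeriod w (length t)
  border⇒HasPeriod {t} {v} {z} refl eq = period λ i lt →
    let i<v : i < length v
        i<v = ℕ.+-cancelˡ-< (length t) i (length v)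
          (subst₂ _<_ (+-comm i (length t)) (length-++ t) lt)
    in begin
    (t ++ v) ! i              ≡⟨ cong (_! i) eq ⟨
    (v ++ z) ! i              ≡⟨ !-++ˡ v i<v ⟩
    v ! i                     ≡⟨ !-++ʳ t i ⟨
    (t ++ v) ! (length t + i) ≡⟨ cong ((t ++ v) !_) (+-comm (length t) i) ⟩
    (t ++ v) ! (i + length t) ∎
    where open ≡-Reasoning

  HasPeriod-* : ∀ {w : List A} {d} k → HasPeriod w d → HasPeriod w (k * d)
  HasPeriod-* {w} zero    _   = period λ i _ → cong (w !_) (sym (ℕ.+-identityʳ i))
  HasPeriod-* {w} {d} (suc k) per = period λ i lt →
    let lt′ : i + d + k * d < length w
        lt′ = subst (_< length w) (sym (+-assoc i d (k * d))) lt
    in begin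
    w ! i                 ≡⟨ shift per i (≤-<-trans (m≤m+n (i + d) (k * d)) lt′) ⟩
    w ! (i + d)           ≡⟨ shift (HasPeriod-* k per) (i + d) lt′ ⟩
    w ! (i + d + k * d)   ≡⟨ cong (w !_) (+-assoc i d (k * d)) ⟩
    w ! (i + (d + k * d)) ∎
    where open ≡-Reasoning

  HasPeriod-∣ : ∀ {w : List A} {d p} → d ∣ p → HasPeriod w d → HasPeriod w p
  HasPeriod-∣ (divides k refl) = HasPeriod-* k

  shift-back : ∀ {w : List A} {p} → HasPeriod w p →
    ∀ j → p + j < length w → w ! (p + j) ≡ w ! j
  shift-back {w} {p} per j lt =
    sym (trans (shift per j (subst (_< length w) (+-comm p j) lt)) (cong (w !_) (+-comm j p)))

  HasPeriod-difference : ∀ {w : List A} {p r} →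
    HasPeriod w p → HasPeriod w (p + r) → p + (p + r) ≤ length w → HasPeriod w r
  HasPeriod-difference {w} {p} {r} hp hq le = period shift-r
    where
    open ≡-Reasoning
    shift-r : ∀ i → i + r < length w → w ! i ≡ w ! (i + r)
    shift-r i lt with <-or-+ p i
    ... | inj₁ i<p = begin
      w ! i             ≡⟨ shift hq i i+q<N ⟩
      w ! (i + (p + r)) ≡⟨ cong (w !_) (reorder i p r) ⟩
      w ! (i + r + p)   ≡⟨ shift hp (i + r) (subst (_< length w) (reorder i p r) i+q<N) ⟨
      w ! (i + r)       ∎
      where
      reorder : ∀ i p r → i + (p + r) ≡ i + r + p
      reorder = solve-∀
      i+q<N : i + (p + r) < length w
      i+q<N = <-≤-trans (ℕ.+-monoˡ-< (p + r) i<p) le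
    ... | inj₂ (j , refl) = begin
      w ! (p + j)       ≡⟨ shift-back hp j (≤-<-trans (m≤m+n (p + j) r) lt) ⟩
      w ! j             ≡⟨ shift hq j (subst (_< length w) (reorder p j r) lt) ⟩
      w ! (j + (p + r)) ≡⟨ cong (w !_) (reorder p j r) ⟨
      w ! (p + j + r)   ∎
      where
      reorder : ∀ p j r → p + j + r ≡ j + (p + r)
      reorder = solve-∀

  fineWilf : ∀ {w : List A} p q →
    HasPeriod w p → HasPeriod w q → p + q ≤ length w → HasPeriod w (gcd p q)
  fineWilf p q = go p q (<-wellFounded (p + q))
    where
    go : ∀ {w : List A} p q → Acc _<_ (p + q) →
      HasPeriod w p → HasPeriod w q → p + q ≤ length w → HasPeriod w (gcd p q)
    go zero q _ _ hq _ = subst (HasPeriod _) (sym (gcd-identityˡ q)) hq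
    go p@(suc _) zero _ hp _ _ = subst (HasPeriod _) (sym (gcd-identityʳ p)) hp
    go {w} p@(suc _) q@(suc _) (acc rs) hp hq le with ℕ.≤-total p q
    ... | inj₁ p≤q with r , refl ← ℕ.m≤n⇒∃[o]m+o≡n p≤q =
      subst (HasPeriod _) (sym (gcd[m,m+n]≡gcd[m,n] p r))
        (go p r (rs (ℕ.+-monoʳ-< p (ℕ.m<n+m r ℕ.z<s)))
          hp (HasPeriod-difference hp hq le) (≤-trans (m≤n+m (p + r) p) le))
    ... | inj₂ q≤p with r , refl ← ℕ.m≤n⇒∃[o]m+o≡n q≤p =
      subst (HasPeriod _)
        (trans (gcd-comm r q) (trans (sym (gcd[m,m+n]≡gcd[m,n] q r)) (gcd-comm q (q + r))))
        (go r q (rs (subst (_< q + r + q) (+-comm q r) (ℕ.m<m+n (q + r) ℕ.z<s)))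
          (HasPeriod-difference hq hp (subst (_≤ length w) (+-comm (q + r) q) le)) hq
          (≤-trans (m≤n+m (r + q) q) (subst (_≤ length w) (+-assoc q r q) le)))

  HasPeriod-extend : ∀ {u v : List A} {q d} → 0 < q →
    HasPeriod (u ++ v) q → HasPeriod u d → q + d ≤ length u → HasPeriod (u ++ v) d
  HasPeriod-extend {u} {v} {q} {d} 0<q hq hd le = period (<-rec _ shift-d)
    where
    open ≡-Reasoning
    w = u ++ v
    shift-d : ∀ i → (∀ {j} → j < i → j + d < length w → w ! j ≡ w ! (j + d)) →
              i + d < length w → w ! i ≡ w ! (i + d)
    shift-d i rec lt with <-or-+ q i
    ... | inj₁ i<q = begin
      w ! i       ≡⟨ !-++ˡ u (≤-<-trans (m≤m+n i d) i+d<u) ⟩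
      u ! i       ≡⟨ shift hd i i+d<u ⟩
      u ! (i + d) ≡⟨ !-++ˡ u i+d<u ⟨
      w ! (i + d) ∎
      where
      i+d<u : i + d < length u
      i+d<u = <-≤-trans (ℕ.+-monoˡ-< d i<q) le
    ... | inj₂ (j , refl) = begin
      w ! (q + j)       ≡⟨ shift-back hq j (≤-<-trans (m≤m+n (q + j) d) lt) ⟩
      w ! j             ≡⟨ rec (ℕ.m<n+m j 0<q) (≤-<-trans (m≤n+m (j + d) q) lt′) ⟩
      w ! (j + d)       ≡⟨ shift-back hq (j + d) lt′ ⟨
      w ! (q + (j + d)) ≡⟨ cong (w !_) (+-assoc q j d) ⟨
      w ! (q + j + d)   ∎
      where
      lt′ : q + (j + d) < length w
      lt′ = subst (_< length w) (+-assoc q j d) lt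

  ≡-by-HasPeriod : ∀ {u v : List A} {p} → 0 < p → HasPeriod u p → HasPeriod v p →
    length u ≡ length v → (∀ i → i < p → u ! i ≡ v ! i) → u ≡ v
  ≡-by-HasPeriod {u} {v} {p} 0<p hu hv len agree = !-ext len (λ i → <-rec _ agree′ i)
    where
    open ≡-Reasoning
    agree′ : ∀ i → (∀ {j} → j < i → j < length u → u ! j ≡ v ! j) →
             i < length u → u ! i ≡ v ! i
    agree′ i rec lt with <-or-+ p i
    ... | inj₁ i<p = agree i i<p
    ... | inj₂ (j , refl) = begin
      u ! (p + j) ≡⟨ shift-back hu j lt ⟩
      u ! j       ≡⟨ rec (ℕ.m<n+m j 0<p) (≤-<-trans (m≤n+m j p) lt) ⟩
      v ! j       ≡⟨ shift-back hv j (subst (p + j <_) len lt) ⟨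
      v ! (p + j) ∎

  repeat : List A → ℕ → List A
  repeat u k = concat (replicate k u)

  length-repeat : ∀ (u : List A) k → length (repeat u k) ≡ k * length u
  length-repeat u zero    = refl
  length-repeat u (suc k) =
    trans (length-++ u) (cong (_+_ (length u)) (length-repeat u k))

  repeat-sucʳ : ∀ (u : List A) k → repeat u (suc k) ≡ repeat u k ++ u
  repeat-sucʳ u zero    = List.++-identityʳ u
  repeat-sucʳ u (suc k) =
    trans (cong (u ++_) (repeat-sucʳ u k)) (sym (++-assoc u (repeat u k) u))

  HasPeriod-repeat : ∀ (u : List A) k → HasPeriod (repeat u k) (length u)
  HasPeriod-repeat u zero    = period λ _ ()
  HasPeriod-repeat u (suc k) = border⇒HasPeriod {t = u} refl (sym (repeat-sucʳ u k))

  length-pow : ∀ {v : List A} p → 0 < length v → length (pow v p) ≡ p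
  length-pow {v} p 0<v = trans (List.length-take p (repeat v p)) (ℕ.m≤n⇒m⊓n≡m
    (subst (p ≤_) (sym (length-repeat v p)) (ℕ.m≤m*n p (length v) {{ℕ.>-nonZero 0<v}})))

  HasPeriod-pow : ∀ (v : List A) p → HasPeriod (pow v p) (length v)
  HasPeriod-pow v p = HasPeriod-take p (HasPeriod-repeat v p)

  HasPeriod⇒≡pow : ∀ {w : List A} {p} → 0 < p → p ≤ length w → HasPeriod w p →
    w ≡ pow (take p w) (length w)
  HasPeriod⇒≡pow {[]}         ()  z≤n _
  HasPeriod⇒≡pow {w@(c ∷ cs)} {p} 0<p p≤w per =
    ≡-by-HasPeriod 0<p per (subst (HasPeriod (pow v N)) |v|≡p (HasPeriod-pow v N))
      (sym (length-pow {v = v} N (subst (0 <_) (sym |v|≡p) 0<p))) agree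
    where
    open ≡-Reasoning
    v = take p w
    N = length w
    |v|≡p : length v ≡ p
    |v|≡p = trans (List.length-take p w) (ℕ.m≤n⇒m⊓n≡m p≤w)
    agree : ∀ i → i < p → w ! i ≡ pow v N ! i
    agree i i<p = begin
      w ! i          ≡⟨ !-take p w i<p ⟨
      v ! i          ≡⟨ !-++ˡ v (subst (i <_) (sym |v|≡p) i<p) ⟨
      repeat v N ! i ≡⟨ !-take N (repeat v N) (<-≤-trans i<p p≤w) ⟨
      pow v N ! i    ∎

  -- Fractional powers and exponents

  IsPowerOf⇒HasPeriod : ∀ {w : List A} {r} → IsPowerOf w r →
    ∃[ k ] HasPeriod w (suc k) × r ≡ + length w / suc k
  IsPowerOf⇒HasPeriod (x , xs , p , refl , refl) =
    length xs , HasPeriod-pow (x ∷ xs) p ,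
    cong (λ n → + n / suc (length xs)) (sym (length-pow {v = x ∷ xs} p (s≤s z≤n)))

  HasPeriod⇒IsPowerOf : ∀ {w : List A} k → HasPeriod w (suc k) → suc k ≤ length w →
    IsPowerOf w (+ length w / suc k)
  HasPeriod⇒IsPowerOf {c ∷ cs} k per le =
    c , take k cs , length (c ∷ cs) ,
    cong (λ n → + length (c ∷ cs) / suc n)
      (sym (trans (List.length-take k cs) (ℕ.m≤n⇒m⊓n≡m (ℕ.≤-pred le)))) ,
    HasPeriod⇒≡pow (s≤s z≤n) le per

  module _ (_≟_ : DecidableEquality A) where

    HasPeriod? : ∀ w p → Dec (HasPeriod w p)
    HasPeriod? w p = map′
      (λ all → period λ i lt → all (ℕ.m+n≤o⇒m≤o∸n (suc i) lt))
      (λ per {i} lt → shift per i (ℕ.m≤o∸n⇒m+n≤o (suc i) (p≤w lt) lt))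
      (ℕ.allUpTo? (λ i → Maybe.≡-dec _≟_ (w ! i) (w ! (i + p))) (length w ∸ p))
      where
      p≤w : ∀ {i} → i < length w ∸ p → p ≤ length w
      p≤w {i} lt = ℕ.<⇒≤ (ℕ.m∸n≢0⇒n<m λ eq → ℕ.n≮0 (subst (i <_) eq lt))

    -- The least positive period p of w gives the largest exponent |w| / p.
    exponent-exists : ∀ {w : List A} → 0 < length w → ∃[ e ] IsExponent w e
    exponent-exists {w} 0<w
      with least-witness (λ p → (0 <? p) ×-dec HasPeriod? w p) (0<w , HasPeriod-length w)
    ... | suc k , (_ , per) , least =
      + length w / suc k ,
      maximum⇒IsSup (HasPeriod⇒IsPowerOf k per (≮⇒≥ λ w<p → least w<p (0<w , HasPeriod-length w)))
        λ r pow → let (k′ , per′ , r≡) = IsPowerOf⇒HasPeriod pow in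
          subst (ℚ._≤ + length w / suc k) (sym r≡)
            (*≤*⇒/≤/ (length w) (length w) k′ k
              (ℕ.*-monoʳ-≤ (length w) (≮⇒≥ λ k′<k → least k′<k (s≤s z≤n , per′))))

  -- The words (uv)^(2+m) vu

  noncommuting⇒nonempty : ∀ {u v : List A} → u ++ v ≢ v ++ u → 0 < length (u ++ v)
  noncommuting⇒nonempty {[]}    {v} uv≢vu = ⊥-elim (uv≢vu (sym (List.++-identityʳ v)))
  noncommuting⇒nonempty {_ ∷ _}     _     = s≤s z≤n

  length-repeat-++ : ∀ (u v : List A) m →
    length (repeat (u ++ v) (2 + m) ++ (v ++ u)) ≡ (3 + m) * length (u ++ v)
  length-repeat-++ u v m = trans (length-++ (repeat (u ++ v) (2 + m)))
    (trans (cong₂ _+_ (length-repeat (u ++ v) (2 + m)) (List.length-++-comm v u))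
      (one-more m (length (u ++ v))))
    where
    one-more : ∀ m L → (2 + m) * L + L ≡ (3 + m) * L
    one-more = solve-∀

  no-short-period : ∀ {u v : List A} → u ++ v ≢ v ++ u → ∀ m {q} → 0 < q →
    HasPeriod (repeat (u ++ v) (2 + m) ++ (v ++ u)) q → suc m * length (u ++ v) ≤ q
  no-short-period {u} {v} uv≢vu m {q} 0<q per = ≮⇒≥ λ q<P → uv≢vu (X≡Y q<P)
    where
    X = u ++ v
    Y = v ++ u
    L = length X
    P = repeat X (2 + m)
    W = P ++ Y

    |P| : length P ≡ L + suc m * L
    |P| = length-repeat X (2 + m)

    |W| : length W ≡ L + length P
    |W| = trans (length-++ P)
      (trans (cong (_+_ (length P)) (List.length-++-comm v u)) (+-comm (length P) L))

    X≡Y : q < suc m * L → X ≡ Y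
    X≡Y q<P = !-ext (List.length-++-comm u v) agree
      where
      open ≡-Reasoning
      instance _ = ℕ.>-nonZero (noncommuting⇒nonempty {u} {v} uv≢vu)
      q+L≤P : q + L ≤ length P
      q+L≤P = subst (q + L ≤_) (trans (+-comm (suc m * L) L) (sym |P|))
        (ℕ.+-monoˡ-≤ L (ℕ.<⇒≤ q<P))
      d = gcd q L
      per-d : HasPeriod W d
      per-d = HasPeriod-extend 0<q per
        (fineWilf q L (HasPeriod-++ˡ per) (HasPeriod-repeat X (2 + m)) q+L≤P)
        (≤-trans (ℕ.+-monoʳ-≤ q (gcd[m,n]≤n q L)) q+L≤P)
      per-P : HasPeriod W (length P)
      per-P = HasPeriod-∣ (subst (d ∣_) (sym (length-repeat X (2 + m)))
        (∣-trans (gcd[m,n]∣n q L) (n∣m*n (2 + m)))) per-d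
      agree : ∀ i → i < L → X ! i ≡ Y ! i
      agree i i<L = begin
        X ! i              ≡⟨ !-++ˡ X i<L ⟨
        P ! i              ≡⟨ !-++ˡ P i<P ⟨
        W ! i              ≡⟨ shift per-P i i+P<W ⟩
        W ! (i + length P) ≡⟨ cong (W !_) (+-comm i (length P)) ⟩
        W ! (length P + i) ≡⟨ !-++ʳ P i ⟩
        Y ! i              ∎
        where
        i<P : i < length P
        i<P = <-≤-trans i<L (subst (L ≤_) (sym |P|) (m≤m+n L (suc m * L)))
        i+P<W : i + length P < length W
        i+P<W = subst (i + length P <_) (sym |W|) (ℕ.+-monoˡ-< (length P) i<L)

  exponent-bound : ∀ {u v : List A} → u ++ v ≢ v ++ u → ∀ m {r} →
    IsPowerOf (repeat (u ++ v) (2 + m) ++ (v ++ u)) r → r ℚ.≤ + (3 + m) / suc m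
  exponent-bound {u} {v} uv≢vu m pow with IsPowerOf⇒HasPeriod pow
  ... | k , per , refl =
    subst (λ n → + n / suc k ℚ.≤ + (3 + m) / suc m) (sym (length-repeat-++ u v m))
      (*≤*⇒/≤/ ((3 + m) * L) (3 + m) k m (begin
        (3 + m) * L * suc m   ≡⟨ reorder (3 + m) L (suc m) ⟩
        (3 + m) * (suc m * L) ≤⟨ ℕ.*-monoʳ-≤ (3 + m) (no-short-period {u} {v} uv≢vu m (s≤s z≤n) per) ⟩
        (3 + m) * suc k       ∎))
    where
    open ℕ.≤-Reasoning
    L = length (u ++ v)
    reorder : ∀ a b c → a * b * c ≡ a * (c * b)
    reorder = solve-∀

  -- Prefix codes

  Comparable : List A → List A → Set
  Comparable u v = (∃[ r ] u ++ r ≡ v) ⊎ (∃[ r ] v ++ r ≡ u)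

  ++⇒Comparable : ∀ u {r} v {r′} → u ++ r ≡ v ++ r′ → Comparable u v
  ++⇒Comparable []      v       _  = inj₁ (v , refl)
  ++⇒Comparable (a ∷ u) []      _  = inj₂ (a ∷ u , refl)
  ++⇒Comparable (a ∷ u) (b ∷ v) eq with refl ← List.∷-injectiveˡ eq
    with ++⇒Comparable u v (List.∷-injectiveʳ eq)
  ... | inj₁ (r , refl) = inj₁ (r , refl)
  ... | inj₂ (r , refl) = inj₂ (r , refl)

  Comparable-head : ∀ {a b : A} {u v} → Comparable (a ∷ u) (b ∷ v) → a ≡ b
  Comparable-head (inj₁ (_ , refl)) = refl
  Comparable-head (inj₂ (_ , refl)) = refl

  Comparable-tail : ∀ {a b : A} {u v} → Comparable (a ∷ u) (b ∷ v) → Comparable u v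
  Comparable-tail (inj₁ (r , eq)) = inj₁ (r , List.∷-injectiveʳ eq)
  Comparable-tail (inj₂ (r , eq)) = inj₂ (r , List.∷-injectiveʳ eq)

  -- With u = x(yx)^K and v = yx, (uv)(vu) = xy(uv)u; hence (uv)u is a border of
  -- (uv)^(2+m) vu, of length 2|uv| - 2.
  module Witness (x y : A) (K : ℕ) where

    R = repeat (y ∷ x ∷ []) K
    u = x ∷ R
    v = y ∷ x ∷ []

    length-uv : length (u ++ v) ≡ 3 + 2 * K
    length-uv = begin
      length (u ++ v)    ≡⟨ length-++ u ⟩
      suc (length R) + 2 ≡⟨ cong (λ n → suc n + 2) (length-repeat (y ∷ x ∷ []) K) ⟩
      suc (K * 2) + 2    ≡⟨ arith K ⟩
      3 + 2 * K          ∎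
      where
      open ≡-Reasoning
      arith : ∀ K → suc (K * 2) + 2 ≡ 3 + 2 * K
      arith = solve-∀

    R-yx : ∀ r → R ++ y ∷ x ∷ r ≡ y ∷ x ∷ (R ++ r)
    R-yx r = trans (sym (++-assoc R v r)) (cong (_++ r) (sym (repeat-sucʳ v K)))

    uvvu : (u ++ v) ++ (v ++ u) ≡ x ∷ y ∷ ((u ++ v) ++ u)
    uvvu = cong (x ∷_) (begin
      (R ++ v) ++ y ∷ x ∷ u    ≡⟨ ++-assoc R v (v ++ u) ⟩
      R ++ y ∷ x ∷ y ∷ x ∷ u   ≡⟨ R-yx (y ∷ x ∷ u) ⟩
      y ∷ x ∷ (R ++ y ∷ x ∷ u) ≡⟨ cong (λ r → y ∷ x ∷ r) (++-assoc R v u) ⟨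
      y ∷ x ∷ ((R ++ v) ++ u)  ∎)
      where open ≡-Reasoning

    HasPeriod-witness : ∀ m →
      HasPeriod (repeat (u ++ v) (2 + m) ++ (v ++ u)) (2 + suc m * length (u ++ v))
    HasPeriod-witness m = subst (HasPeriod W) |t|
      (border⇒HasPeriod {t = t} {v = X ++ u} {z = v ++ repeat X m ++ Y} t-border border-rest)
      where
      open ≡-Reasoning
      X = u ++ v
      Y = v ++ u
      W = repeat X (2 + m) ++ Y
      t = repeat X (suc m) ++ x ∷ y ∷ []

      |t| : length t ≡ 2 + suc m * length X
      |t| = trans (length-++ (repeat X (suc m)))
        (trans (cong (_+ 2) (length-repeat X (suc m))) (+-comm _ 2))

      t-border : t ++ (X ++ u) ≡ W
      t-border = begin
        t ++ (X ++ u)                        ≡⟨ ++-assoc (repeat X (suc m)) (x ∷ y ∷ []) (X ++ u) ⟩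
        repeat X (suc m) ++ x ∷ y ∷ (X ++ u) ≡⟨ cong (repeat X (suc m) ++_) uvvu ⟨
        repeat X (suc m) ++ (X ++ Y)         ≡⟨ ++-assoc (repeat X (suc m)) X Y ⟨
        (repeat X (suc m) ++ X) ++ Y         ≡⟨ cong (_++ Y) (repeat-sucʳ X (suc m)) ⟨
        W                                    ∎

      border-rest : (X ++ u) ++ (v ++ repeat X m ++ Y) ≡ W
      border-rest = begin
        (X ++ u) ++ (v ++ repeat X m ++ Y) ≡⟨ ++-assoc X u _ ⟩
        X ++ (u ++ (v ++ repeat X m ++ Y)) ≡⟨ cong (X ++_) (++-assoc u v _) ⟨
        X ++ (X ++ repeat X m ++ Y)        ≡⟨ cong (X ++_) (++-assoc X (repeat X m) Y) ⟨
        X ++ ((X ++ repeat X m) ++ Y)      ≡⟨ ++-assoc X (X ++ repeat X m) Y ⟨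
        W                                  ∎

    -- A prefix code with u and v as the codewords 0 and 1.
    codeword : ℕ → List A
    codeword zero    = u
    codeword (suc j) = replicate (suc j) y ++ x ∷ []

    codeword-nonempty : ∀ i → codeword i ≢ []
    codeword-nonempty zero    ()
    codeword-nonempty (suc i) ()

    module _ (x≢y : x ≢ y) where

      yⁱx-prefixFree : ∀ i j →
        Comparable (replicate i y ++ x ∷ []) (replicate j y ++ x ∷ []) → i ≡ j
      yⁱx-prefixFree zero    zero    _ = refl
      yⁱx-prefixFree zero    (suc j) c = ⊥-elim (x≢y (Comparable-head c))
      yⁱx-prefixFree (suc i) zero    c = ⊥-elim (x≢y (sym (Comparable-head c)))
      yⁱx-prefixFree (suc i) (suc j) c = cong suc (yⁱx-prefixFree i j (Comparable-tail c))

      codeword-prefixFree : ∀ i j → Comparable (codeword i) (codeword j) → i ≡ j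
      codeword-prefixFree zero    zero    _ = refl
      codeword-prefixFree zero    (suc j) c = ⊥-elim (x≢y (Comparable-head c))
      codeword-prefixFree (suc i) zero    c = ⊥-elim (x≢y (sym (Comparable-head c)))
      codeword-prefixFree (suc i) (suc j) c = yⁱx-prefixFree (suc i) (suc j) c
-- Morphisms

module _ {s g : ℕ} (h : Morphism s g) where

  apply-++ : ∀ u w → apply h (u ++ w) ≡ apply h u ++ apply h w
  apply-++ = List.concatMap-++ h

  apply-repeat : ∀ u k → apply h (repeat u k) ≡ repeat (apply h u) k
  apply-repeat u zero    = refl
  apply-repeat u (suc k) =
    trans (apply-++ u (repeat u k)) (cong (apply h u ++_) (apply-repeat u k))

  apply-pair : ∀ a b → apply h (a ∷ b ∷ []) ≡ h a ++ h b
  apply-pair a b = cong (h a ++_) (List.++-identityʳ (h b))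

  apply-word : ∀ a b n → apply h (word a b n) ≡ repeat (h a ++ h b) n ++ (h b ++ h a)
  apply-word a b n = begin
    apply h (repeat ab n ++ ba)           ≡⟨ apply-++ (repeat ab n) ba ⟩
    apply h (repeat ab n) ++ apply h ba   ≡⟨ cong₂ _++_ (apply-repeat ab n) (apply-pair b a) ⟩
    repeat (apply h ab) n ++ (h b ++ h a) ≡⟨ cong (λ X → repeat X n ++ (h b ++ h a)) (apply-pair a b) ⟩
    repeat (h a ++ h b) n ++ (h b ++ h a) ∎
    where
    open ≡-Reasoning
    ab = a ∷ b ∷ []
    ba = b ∷ a ∷ []

  Injective⇒noncommuting : Injective h → ∀ {a b} → a ≢ b → h a ++ h b ≢ h b ++ h a
  Injective⇒noncommuting inj {a} {b} a≢b eq = a≢b (List.∷-injectiveˡ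
    (inj (a ∷ b ∷ []) (b ∷ a ∷ []) (trans (apply-pair a b) (trans eq (sym (apply-pair b a))))))

  prefixCode⇒Injective : (∀ c → h c ≢ []) →
    (∀ c c′ → Comparable (h c) (h c′) → c ≡ c′) → Injective h
  prefixCode⇒Injective nonempty prefixFree = inj
    where
    inj : Injective h
    inj []      []       _  = refl
    inj []      (c ∷ w)  eq = ⊥-elim (nonempty c (List.++-conicalˡ (h c) _ (sym eq)))
    inj (c ∷ u) []       eq = ⊥-elim (nonempty c (List.++-conicalˡ (h c) _ eq))
    inj (c ∷ u) (c′ ∷ w) eq with refl ← prefixFree c c′ (++⇒Comparable (h c) (h c′) eq) =
      cong (c ∷_) (inj u w (List.++-cancelˡ (h c) _ _ eq))

module _ {s : ℕ} (a b : Fin s) where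

  rank : ∀ c → Dec (c ≡ a) → Dec (c ≡ b) → ℕ
  rank _ (yes _) _       = 0
  rank _ (no _)  (yes _) = 1
  rank c (no _)  (no _)  = 2 + toℕ c

  rank-injective : ∀ {c c′} ca cb c′a c′b → rank c ca cb ≡ rank c′ c′a c′b → c ≡ c′
  rank-injective (yes refl) _          (yes refl) _          _  = refl
  rank-injective (no _)     (yes refl) (no _)     (yes refl) _  = refl
  rank-injective (no _)     (no _)     (no _)     (no _)     eq =
    Fin.toℕ-injective (ℕ.suc-injective (ℕ.suc-injective eq))
  rank-injective (yes _)    _          (no _)     (yes _)    ()
  rank-injective (yes _)    _          (no _)     (no _)     ()
  rank-injective (no _)     (yes _)    (yes _)    _          ()
  rank-injective (no _)     (yes _)    (no _)     (no _)     ()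
  rank-injective (no _)     (no _)     (yes _)    _          ()
  rank-injective (no _)     (no _)     (no _)     (yes _)    ()

  rankOf : Fin s → ℕ
  rankOf c = rank c (c Fin.≟ a) (c Fin.≟ b)

  rankOf-injective : ∀ {c c′} → rankOf c ≡ rankOf c′ → c ≡ c′
  rankOf-injective {c} {c′} = rank-injective (c Fin.≟ a) (c Fin.≟ b) (c′ Fin.≟ a) (c′ Fin.≟ b)

  rankOf-a : rankOf a ≡ 0
  rankOf-a with a Fin.≟ a
  ... | yes _   = refl
  ... | no  a≢a = ⊥-elim (a≢a refl)

  rankOf-b : a ≢ b → rankOf b ≡ 1
  rankOf-b a≢b with b Fin.≟ a | b Fin.≟ b
  ... | yes b≡a | _       = ⊥-elim (a≢b (sym b≡a))
  ... | no _    | yes _   = refl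
  ... | no _    | no  b≢b = ⊥-elim (b≢b refl)

module _ {s g′ : ℕ} (a b : Fin s) (K : ℕ) where

  open Witness {A = Fin (2 + g′)} fzero (fsuc fzero) K

  witness : Morphism s (2 + g′)
  witness c = codeword (rankOf a b c)

  witness-injective : Injective witness
  witness-injective = prefixCode⇒Injective witness (λ c → codeword-nonempty (rankOf a b c))
    (λ c c′ cmp → rankOf-injective a b (codeword-prefixFree (λ ()) _ _ cmp))

  apply-witness-word : a ≢ b → ∀ m →
    apply witness (word a b (2 + m)) ≡ repeat (u ++ v) (2 + m) ++ (v ++ u)
  apply-witness-word a≢b m = trans (apply-word witness a b (2 + m))
    (cong₂ (λ p q → repeat (p ++ q) (2 + m) ++ (q ++ p))
      (cong codeword (rankOf-a a b)) (cong codeword (rankOf-b a b a≢b)))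

upper-bound : ∀ {s g} (h : Morphism s g) → Injective h → ∀ {a b} → a ≢ b → ∀ m {r} →
  IsExponent (apply h (word a b (2 + m))) r → r ℚ.≤ + (3 + m) / suc m
upper-bound h inj {a} {b} a≢b m E = IsSup-least E λ r pow →
  exponent-bound {u = h a} {h b} (Injective⇒noncommuting h inj a≢b) m
    (subst (λ w → IsPowerOf w r) (apply-word h a b (2 + m)) pow)

lower-bound : ∀ {s g′} {a b : Fin s} → a ≢ b → ∀ m q → q ℚ.< + (3 + m) / suc m →
  ∃[ r ] (Σ (Morphism s (2 + g′)) λ h → Injective h × IsExponent (apply h (word a b (2 + m))) r)
    × q ℚ.< r
lower-bound {s} {g′} {a} {b} a≢b m q q<b =
  e ,
  (witness a b K , witness-injective a b K ,
    subst (λ w → IsExponent w e) (sym (apply-witness-word a b K a≢b m)) E) ,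
  ℚ.<-≤-trans q<ratio (proj₁ E _ (HasPeriod⇒IsPowerOf _ (HasPeriod-witness m) period≤W))
  where
  K = ℤ.∣ ℚ.↥ q ∣
  open Witness {A = Fin (2 + g′)} fzero (fsuc fzero) K
  L = length (u ++ v)
  W = repeat (u ++ v) (2 + m) ++ (v ++ u)
  E′ = exponent-exists Fin._≟_ {W} (s≤s z≤n)
  e = proj₁ E′
  E = proj₂ E′
  period≤W : 2 + suc m * L ≤ length W
  period≤W = subst (2 + suc m * L ≤_) (sym (length-repeat-++ u v m))
    (≤-trans (ℕ.+-monoˡ-≤ (suc m * L) (subst (2 ≤_) (sym length-uv) (s≤s (s≤s z≤n))))
      (m≤n+m (L + suc m * L) L))
  P*2<L : ℚ.↥ q ℤ.* + 2 ℤ.< + L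
  P*2<L = subst (λ n → ℚ.↥ q ℤ.* + 2 ℤ.< + n) (sym length-uv) (P*2<3+2∣P∣ (ℚ.↥ q))
  q<ratio : q ℚ.< + length W / (2 + suc m * L)
  q<ratio = subst (λ n → q ℚ.< + n / (2 + suc m * L)) (sym (length-repeat-++ u v m))
    (ratio-exceeds q m L P*2<L q<b)

-- The hypothesis 2 ≤ s is implied by a ≢ b.
mainTheorem3 : (s g : ℕ) → 2 ≤ s → 2 ≤ g → (a b : Fin s) → a ≢ b →
    (n : ℕ) → (hn : 2 ≤ n) →
    IsInjExponent s g (word a b n) (bound n hn)
mainTheorem3 s (suc (suc g′)) _ _ a b a≢b (suc (suc m)) _ =
  subst (IsInjExponent s (2 + g′) (word a b (2 + m))) (sym (1+2/[1+m]≡[3+m]/[1+m] m))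
    ((λ r (h , inj , E) → upper-bound h inj a≢b m E) , lower-bound a≢b m)
mainTheorem3 _ zero          _ ()       _ _ _ _          _
mainTheorem3 _ (suc zero)    _ (s≤s ()) _ _ _ _          _
mainTheorem3 _ (suc (suc _)) _ _        _ _ _ zero       ()
mainTheorem3 _ (suc (suc _)) _ _        _ _ _ (suc zero) (s≤s ())
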